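{- Let $r\ge 2$ and $n\ge 0$. With $U_{n,\ell}^{(r)}$ the total number of $\mathbf{u}$-steps at level $\ell+1$ over all paths in $\mathcal{A}_{n+1,0}^{(r)}$ and $S_n^{(r)}=|\mathcal{A}_{n,0}^{(r)}|$, $$\sum_{\ell=0}^{n}(-1)^{\ell}(\ell+1)U_{n,\ell}^{(r)}=(n+1)+(r-1)\sum_{\ell=0}^{n}(\ell+1)S_{n-\ell}^{(r)}.$$
   Context: A Dyck path of length $2n$ is a lattice path from $(0,0)$ to $(2n,0)$ weakly above the $x$-axis with steps $\mathbf{u}=(1,1)$, $\mathbf{d}=(1,-1)$; an $r$-colored Dyck path has each $\mathbf{d}$-step colored with one of $r$ colors. $\mathcal{A}_{n,0}^{(r)}$ is the set of $r$-colored Dyck paths of length $2n$ with no two consecutive $\mathbf{d}$-steps of the same color. A step is at level $\ell$ if the ordinate of its endpoint is $\ell$. $S_n^{(r)}$ is the coefficient of $x^n$ in the power series $S_r(x)$ with $S_r=1+xS_r+(r-1)xS_r^2$. -}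

module Defs where

open import Data.Nat using (ℕ; zero; suc; _+_; _*_; _∸_; _≤?_)
open import Data.Fin using (Fin; _≟_)
open import Data.List using (List; []; _∷_; map; concatMap; length; filter; allFin; upTo; _++_)
open import Data.Nat.ListAction using (sum)
open import Data.Bool using (Bool; true; false; if_then_else_; _∧_; not)
open import Relation.Nullary.Decidable using (⌊_⌋)
open import Data.Integer as ℤ using (ℤ; +_)

data Step (r : ℕ) : Set where
  u : Step r
  d : Fin r → Step r

-- All step sequences with exactly k steps, starting at height h, never going
-- below the x-axis, and ending at height 0.  (Paths are lists of steps.)
paths : (r : ℕ) → ℕ → ℕ → List (List (Step r))
paths r zero zero = [] ∷ []
paths r zero (suc h) = []
paths r (suc k) zero = map (u ∷_) (paths r k 1)
paths r (suc k) (suc h) =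
  map (u ∷_) (paths r k (suc (suc h)))
  ++ concatMap (λ c → map (d c ∷_) (paths r k h)) (allFin r)

dyck : (r n : ℕ) → List (List (Step r))
dyck r n = paths r (n + n) 0

noSameDD : ∀ {r} → List (Step r) → Bool
noSameDD [] = true
noSameDD (d a ∷ d b ∷ s) = not ⌊ a ≟ b ⌋ ∧ noSameDD (d b ∷ s)
noSameDD (_ ∷ s) = noSameDD s

A : (r n : ℕ) → List (List (Step r))
A r n = filter (λ p → noSameDD p Data.Bool.≟ true) (dyck r n)

S : (r n : ℕ) → ℕ
S r n = length (A r n)

uAtLevelFrom : ∀ {r} → ℕ → ℕ → List (Step r) → ℕ
uAtLevelFrom ℓ h [] = 0
uAtLevelFrom ℓ h (u ∷ s) =
  (if ⌊ suc h Data.Nat.≟ ℓ ⌋ then 1 else 0) + uAtLevelFrom ℓ (suc h) s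
uAtLevelFrom ℓ h (d _ ∷ s) = uAtLevelFrom ℓ (h ∸ 1) s

uAtLevel : ∀ {r} → ℕ → List (Step r) → ℕ
uAtLevel ℓ p = uAtLevelFrom ℓ 0 p

U : (r n ℓ : ℕ) → ℕ
U r n ℓ = sum (map (uAtLevel (suc ℓ)) (A r (suc n)))

sign : ℕ → ℤ
sign zero = + 1
sign (suc ℓ) = ℤ.- sign ℓ

Σℤ : ℕ → (ℕ → ℤ) → ℤ
Σℤ n f = Data.List.foldr ℤ._+_ (+ 0) (map f (upTo (suc n)))

Σℕ : ℕ → (ℕ → ℕ) → ℕ
Σℕ n f = sum (map f (upTo (suc n)))

-- For a coloured path p let W(p) = Σ (−1)^ℓ (ℓ + 1) and N(p) = Σ (−1)^ℓ, both over the u-steps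
-- of p, where ℓ is the height a u-step starts from.  No u-step of a Dyck path of length 2n + 2
-- starts above height n, so the left-hand side is the total of W over 𝒜_{n+1,0}.  Cut a path at
-- its first return as u P d Q: the d-step has r colours if P is empty and r − 1 otherwise, and
-- lifting P by one level negates (−1)^ℓ.  With y marking length, the totals over valid paths
-- therefore satisfy S = 1 + y² S (1 + (r − 1) S), N (1 − y²) = S − 1 and
-- W (1 − y²) = S − 1 − (r − 1) y² N S.  Eliminating N gives W (1 − y²)² = y² (1 + (r − 1) S),
-- whose coefficient of y^(2n+2) is the right-hand side.

module Submission where

open import Defs
open import Data.Nat using (ℕ; zero; suc; _+_; _*_; _∸_; _≤_; _≡ᵇ_; s≤s; s≤s⁻¹; z≤n)
import Data.Nat.Properties as ℕ
open import Data.Integer as ℤ using (ℤ; +_)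
open import Data.Integer using (0ℤ; 1ℤ; -_; _-_) renaming (_+_ to _⊕_; _*_ to _⊛_)
import Data.Integer.Properties as ℤ
open import Algebra.Properties.CommutativeSemigroup ℤ.+-commutativeSemigroup
  using () renaming (interchange to +-interchange; x∙yz≈y∙xz to +-left-comm)
open import Data.Integer.Tactic.RingSolver using (solve)
open import Data.Bool using (Bool; true; false; _∧_; not; if_then_else_)
import Data.Bool as Bool
import Data.Bool.Properties as Bool
open import Data.Fin using (Fin; zero; suc)
import Data.Fin as Fin
open import Data.Maybe using (Maybe; just)
open import Data.Product using (Σ; _,_)
open import Data.List using (List; []; _∷_; _++_; map; concatMap; filter; length; foldr; upTo; allFin; last)
import Data.List.Properties as List
open import Data.List.Relation.Unary.All as All using (All)
import Data.List.Relation.Unary.All.Properties as All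
open import Data.Nat.ListAction using (sum)
open import Relation.Nullary.Decidable using (⌊_⌋; ⌊⌋-map′; isYes≗does)
open import Relation.Binary.PropositionalEquality using (_≡_; refl; sym; trans; cong; cong₂; module ≡-Reasoning)

⟦_⟧ : Bool → ℤ
⟦ true  ⟧ = 1ℤ
⟦ false ⟧ = 0ℤ

⟦∧⟧ : ∀ a b → ⟦ a ∧ b ⟧ ≡ ⟦ a ⟧ ⊛ ⟦ b ⟧
⟦∧⟧ true  b = sym (ℤ.*-identityˡ ⟦ b ⟧)
⟦∧⟧ false b = refl

∑ : {A : Set} → List A → (A → ℤ) → ℤ
∑ xs f = foldr _⊕_ 0ℤ (map f xs)

module _ {A : Set} where

  ∑-cong : (xs : List A) {f g : A → ℤ} → (∀ x → f x ≡ g x) → ∑ xs f ≡ ∑ xs g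
  ∑-cong []       f≗g = refl
  ∑-cong (x ∷ xs) f≗g = cong₂ _⊕_ (f≗g x) (∑-cong xs f≗g)

  ∑-congᴬ : {xs : List A} {f g : A → ℤ} → All (λ x → f x ≡ g x) xs → ∑ xs f ≡ ∑ xs g
  ∑-congᴬ All.[]            = refl
  ∑-congᴬ (fx≡gx All.∷ eqs) = cong₂ _⊕_ fx≡gx (∑-congᴬ eqs)

  ∑-zero : (xs : List A) → ∑ xs (λ _ → 0ℤ) ≡ 0ℤ
  ∑-zero []       = refl
  ∑-zero (x ∷ xs) = trans (ℤ.+-identityˡ _) (∑-zero xs)

  ∑-+ : (xs : List A) (f g : A → ℤ) → ∑ xs (λ x → f x ⊕ g x) ≡ ∑ xs f ⊕ ∑ xs g
  ∑-+ []       f g = refl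
  ∑-+ (x ∷ xs) f g = trans (cong (f x ⊕ g x ⊕_) (∑-+ xs f g)) (+-interchange (f x) (g x) (∑ xs f) (∑ xs g))

  ∑-*ˡ : (α : ℤ) (xs : List A) (f : A → ℤ) → ∑ xs (λ x → α ⊛ f x) ≡ α ⊛ ∑ xs f
  ∑-*ˡ α []       f = sym (ℤ.*-zeroʳ α)
  ∑-*ˡ α (x ∷ xs) f = trans (cong (α ⊛ f x ⊕_) (∑-*ˡ α xs f)) (sym (ℤ.*-distribˡ-+ α (f x) (∑ xs f)))

  ∑-*ʳ : (α : ℤ) (xs : List A) (f : A → ℤ) → ∑ xs (λ x → f x ⊛ α) ≡ ∑ xs f ⊛ α
  ∑-*ʳ α xs f = trans (∑-cong xs (λ x → ℤ.*-comm (f x) α)) (trans (∑-*ˡ α xs f) (ℤ.*-comm α (∑ xs f)))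

  ∑-neg : (xs : List A) (f : A → ℤ) → ∑ xs (λ x → - f x) ≡ - ∑ xs f
  ∑-neg xs f = trans (∑-cong xs (λ x → sym (ℤ.-1*i≡-i (f x))))
                     (trans (∑-*ˡ (- 1ℤ) xs f) (ℤ.-1*i≡-i (∑ xs f)))

  ∑-++ : (xs ys : List A) (f : A → ℤ) → ∑ (xs ++ ys) f ≡ ∑ xs f ⊕ ∑ ys f
  ∑-++ []       ys f = sym (ℤ.+-identityˡ (∑ ys f))
  ∑-++ (x ∷ xs) ys f = trans (cong (f x ⊕_) (∑-++ xs ys f)) (sym (ℤ.+-assoc (f x) (∑ xs f) (∑ ys f)))

  ∑-map : {B : Set} (g : B → A) (ys : List B) (f : A → ℤ) → ∑ (map g ys) f ≡ ∑ ys (λ y → f (g y))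
  ∑-map g []       f = refl
  ∑-map g (y ∷ ys) f = cong (f (g y) ⊕_) (∑-map g ys f)

  ∑-concatMap : {B : Set} (g : B → List A) (ys : List B) (f : A → ℤ) →
                ∑ (concatMap g ys) f ≡ ∑ ys (λ y → ∑ (g y) f)
  ∑-concatMap g []       f = refl
  ∑-concatMap g (y ∷ ys) f = trans (∑-++ (g y) (concatMap g ys) f) (cong (∑ (g y) f ⊕_) (∑-concatMap g ys f))

  ∑-filter : (b : A → Bool) (xs : List A) (f : A → ℤ) →
             ∑ (filter (λ x → b x Bool.≟ true) xs) f ≡ ∑ xs (λ x → ⟦ b x ⟧ ⊛ f x)
  ∑-filter b []       f = refl
  ∑-filter b (x ∷ xs) f with b x
  ... | true  = cong₂ _⊕_ (sym (ℤ.*-identityˡ (f x))) (∑-filter b xs f)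
  ... | false = trans (∑-filter b xs f) (sym (ℤ.+-identityˡ _))

  ∑-const : (xs : List A) (α : ℤ) → ∑ xs (λ _ → α) ≡ α ⊛ ∑ xs (λ _ → 1ℤ)
  ∑-const xs α = trans (∑-cong xs (λ _ → sym (ℤ.*-identityʳ α))) (∑-*ˡ α xs (λ _ → 1ℤ))

  +-sum : (f : A → ℕ) (xs : List A) → + sum (map f xs) ≡ ∑ xs (λ x → + f x)
  +-sum f []       = refl
  +-sum f (x ∷ xs) = cong (+ f x ⊕_) (+-sum f xs)

  +-length : (xs : List A) → + length xs ≡ ∑ xs (λ _ → 1ℤ)
  +-length []       = refl
  +-length (x ∷ xs) = cong (1ℤ ⊕_) (+-length xs)

∑-swap : {A B : Set} (xs : List A) (ys : List B) (F : A → B → ℤ) →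
         ∑ xs (λ x → ∑ ys (F x)) ≡ ∑ ys (λ y → ∑ xs (λ x → F x y))
∑-swap []       ys F = sym (∑-zero ys)
∑-swap (x ∷ xs) ys F = trans (cong (∑ ys (F x) ⊕_) (∑-swap xs ys F)) (sym (∑-+ ys (F x) _))

∑-∑-+ : {A B : Set} (xs : List A) (ys : List B) (f : A → ℤ) (g : B → ℤ) →
        ∑ xs (λ x → ∑ ys (λ y → f x ⊕ g y))
          ≡ ∑ xs f ⊛ ∑ ys (λ _ → 1ℤ) ⊕ ∑ xs (λ _ → 1ℤ) ⊛ ∑ ys g
∑-∑-+ xs ys f g = begin
    ∑ xs (λ x → ∑ ys (λ y → f x ⊕ g y))
  ≡⟨ ∑-cong xs (λ x → trans (∑-+ ys (λ _ → f x) g) (cong (_⊕ ∑ ys g) (∑-const ys (f x)))) ⟩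
    ∑ xs (λ x → f x ⊛ ∑ ys (λ _ → 1ℤ) ⊕ ∑ ys g)
  ≡⟨ ∑-+ xs (λ x → f x ⊛ ∑ ys (λ _ → 1ℤ)) (λ _ → ∑ ys g) ⟩
    ∑ xs (λ x → f x ⊛ ∑ ys (λ _ → 1ℤ)) ⊕ ∑ xs (λ _ → ∑ ys g)
  ≡⟨ cong₂ _⊕_ (∑-*ʳ (∑ ys (λ _ → 1ℤ)) xs f)
               (trans (∑-const xs (∑ ys g)) (ℤ.*-comm (∑ ys g) (∑ xs (λ _ → 1ℤ)))) ⟩
    ∑ xs f ⊛ ∑ ys (λ _ → 1ℤ) ⊕ ∑ xs (λ _ → 1ℤ) ⊛ ∑ ys g
  ∎
  where open ≡-Reasoning

∑-allFin-suc : ∀ n (f : Fin (suc n) → ℤ) → ∑ (allFin (suc n)) f ≡ f zero ⊕ ∑ (allFin n) (λ c → f (suc c))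
∑-allFin-suc n f = cong (λ ys → f zero ⊕ foldr _⊕_ 0ℤ ys)
  (trans (List.map-tabulate suc f) (sym (List.map-tabulate (λ c → c) (λ c → f (suc c)))))

∑-allFin-1 : ∀ n → ∑ (allFin n) (λ _ → 1ℤ) ≡ + n
∑-allFin-1 n = trans (sym (+-length (allFin n))) (cong +_ (List.length-tabulate (λ c → c)))

∑-allFin-≠ : ∀ {n} (c′ : Fin n) → ∑ (allFin n) (λ c → ⟦ not ⌊ c′ Fin.≟ c ⌋ ⟧) ≡ + (n ∸ 1)
∑-allFin-≠ {suc n}       zero     =
  trans (∑-allFin-suc n (λ c → ⟦ not ⌊ zero Fin.≟ c ⌋ ⟧)) (trans (ℤ.+-identityˡ _) (∑-allFin-1 n))
∑-allFin-≠ {suc (suc n)} (suc c′) = begin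
    ∑ (allFin (suc (suc n))) (λ c → ⟦ not ⌊ suc c′ Fin.≟ c ⌋ ⟧)
  ≡⟨ ∑-allFin-suc (suc n) (λ c → ⟦ not ⌊ suc c′ Fin.≟ c ⌋ ⟧) ⟩
    1ℤ ⊕ ∑ (allFin (suc n)) (λ c → ⟦ not ⌊ suc c′ Fin.≟ suc c ⌋ ⟧)
  ≡⟨ cong (1ℤ ⊕_) (∑-cong (allFin (suc n)) (λ c →
       cong (λ b → ⟦ not b ⟧) (⌊⌋-map′ _ _ (c′ Fin.≟ c)))) ⟩
    1ℤ ⊕ ∑ (allFin (suc n)) (λ c → ⟦ not ⌊ c′ Fin.≟ c ⌋ ⟧)
  ≡⟨ cong (1ℤ ⊕_) (∑-allFin-≠ c′) ⟩
    + suc n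
  ∎
  where open ≡-Reasoning

Σℤ-peel : ∀ n (f : ℕ → ℤ) → Σℤ (suc n) f ≡ f 0 ⊕ Σℤ n (λ ℓ → f (suc ℓ))
Σℤ-peel n f = cong (λ ys → f 0 ⊕ foldr _⊕_ 0ℤ ys)
  (trans (List.map-applyUpTo suc f (suc n)) (sym (List.map-upTo (λ ℓ → f (suc ℓ)) (suc n))))

Σℤ-δ : ∀ {x n} → x ≤ n → (F : ℕ → ℤ) →
       Σℤ n (λ ℓ → F ℓ ⊛ + (if x ≡ᵇ ℓ then 1 else 0)) ≡ F x
Σℤ-δ {zero} {zero} z≤n F = trans (ℤ.+-identityʳ _) (ℤ.*-identityʳ (F 0))
Σℤ-δ {zero} {suc n} z≤n F = begin
    Σℤ (suc n) (λ ℓ → F ℓ ⊛ + (if 0 ≡ᵇ ℓ then 1 else 0))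
  ≡⟨ Σℤ-peel n (λ ℓ → F ℓ ⊛ + (if 0 ≡ᵇ ℓ then 1 else 0)) ⟩
    F 0 ⊛ 1ℤ ⊕ Σℤ n (λ ℓ → F (suc ℓ) ⊛ 0ℤ)
  ≡⟨ cong₂ _⊕_ (ℤ.*-identityʳ (F 0))
               (trans (∑-cong (upTo (suc n)) (λ ℓ → ℤ.*-zeroʳ (F (suc ℓ)))) (∑-zero (upTo (suc n)))) ⟩
    F 0 ⊕ 0ℤ
  ≡⟨ ℤ.+-identityʳ (F 0) ⟩
    F 0
  ∎
  where open ≡-Reasoning
Σℤ-δ {suc x} {suc n} (s≤s x≤n) F = begin
    Σℤ (suc n) (λ ℓ → F ℓ ⊛ + (if suc x ≡ᵇ ℓ then 1 else 0))
  ≡⟨ Σℤ-peel n (λ ℓ → F ℓ ⊛ + (if suc x ≡ᵇ ℓ then 1 else 0)) ⟩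
    F 0 ⊛ 0ℤ ⊕ Σℤ n (λ ℓ → F (suc ℓ) ⊛ + (if x ≡ᵇ ℓ then 1 else 0))
  ≡⟨ cong₂ _⊕_ (ℤ.*-zeroʳ (F 0)) (Σℤ-δ x≤n (λ ℓ → F (suc ℓ))) ⟩
    0ℤ ⊕ F (suc x)
  ≡⟨ ℤ.+-identityˡ (F (suc x)) ⟩
    F (suc x)
  ∎
  where open ≡-Reasoning

Σℤ-weighted-peel : ∀ n (t : ℕ → ℤ) →
  Σℤ (suc n) (λ ℓ → + suc ℓ ⊛ t (suc n ∸ ℓ))
    ≡ Σℤ n (λ ℓ → + suc ℓ ⊛ t (n ∸ ℓ)) ⊕ Σℤ (suc n) (λ ℓ → t (suc n ∸ ℓ))
Σℤ-weighted-peel n t = begin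
    Σℤ (suc n) (λ ℓ → + suc ℓ ⊛ t (suc n ∸ ℓ))
  ≡⟨ Σℤ-peel n (λ ℓ → + suc ℓ ⊛ t (suc n ∸ ℓ)) ⟩
    1ℤ ⊛ t (suc n) ⊕ Σℤ n (λ ℓ → (1ℤ ⊕ + suc ℓ) ⊛ t (n ∸ ℓ))
  ≡⟨ cong₂ _⊕_ (ℤ.*-identityˡ (t (suc n)))
               (∑-cong (upTo (suc n)) (λ ℓ → suc-* (+ suc ℓ) (t (n ∸ ℓ)))) ⟩
    t (suc n) ⊕ Σℤ n (λ ℓ → + suc ℓ ⊛ t (n ∸ ℓ) ⊕ t (n ∸ ℓ))
  ≡⟨ cong (t (suc n) ⊕_) (∑-+ (upTo (suc n)) (λ ℓ → + suc ℓ ⊛ t (n ∸ ℓ)) (λ ℓ → t (n ∸ ℓ))) ⟩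
    t (suc n) ⊕ (T ⊕ Q)
  ≡⟨ +-left-comm (t (suc n)) T Q ⟩
    T ⊕ (t (suc n) ⊕ Q)
  ≡⟨ cong (T ⊕_) (sym (Σℤ-peel n (λ ℓ → t (suc n ∸ ℓ)))) ⟩
    T ⊕ Σℤ (suc n) (λ ℓ → t (suc n ∸ ℓ))
  ∎
  where
  open ≡-Reasoning
  T Q : ℤ
  T = Σℤ n (λ ℓ → + suc ℓ ⊛ t (n ∸ ℓ))
  Q = Σℤ n (λ ℓ → t (n ∸ ℓ))
  suc-* : ∀ k x → (1ℤ ⊕ k) ⊛ x ≡ k ⊛ x ⊕ x
  suc-* k x = solve (k ∷ x ∷ [])

-- Conv k F = Σ_{a + b + 1 = k} F a b: the coefficient of x^k in x·A(x)·B(x) when F a b = A_a B_b.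
Conv : ℕ → (ℕ → ℕ → ℤ) → ℤ
Conv zero    F = 0ℤ
Conv (suc k) F = F 0 k ⊕ Conv k (λ a b → F (suc a) b)

Conv-cong : ∀ k {F G : ℕ → ℕ → ℤ} → (∀ a b → F a b ≡ G a b) → Conv k F ≡ Conv k G
Conv-cong zero    F≗G = refl
Conv-cong (suc k) F≗G = cong₂ _⊕_ (F≗G 0 k) (Conv-cong k (λ a → F≗G (suc a)))

Conv-zero : ∀ k → Conv k (λ _ _ → 0ℤ) ≡ 0ℤ
Conv-zero zero    = refl
Conv-zero (suc k) = trans (ℤ.+-identityˡ _) (Conv-zero k)

Conv-+ : ∀ k (F G : ℕ → ℕ → ℤ) → Conv k (λ a b → F a b ⊕ G a b) ≡ Conv k F ⊕ Conv k G
Conv-+ zero    F G = refl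
Conv-+ (suc k) F G = trans (cong (F 0 k ⊕ G 0 k ⊕_) (Conv-+ k (λ a → F (suc a)) (λ a → G (suc a))))
                           (+-interchange (F 0 k) (G 0 k) _ _)

Conv-*ˡ : ∀ k (α : ℤ) (F : ℕ → ℕ → ℤ) → Conv k (λ a b → α ⊛ F a b) ≡ α ⊛ Conv k F
Conv-*ˡ zero    α F = sym (ℤ.*-zeroʳ α)
Conv-*ˡ (suc k) α F = trans (cong (α ⊛ F 0 k ⊕_) (Conv-*ˡ k α (λ a → F (suc a))))
                            (sym (ℤ.*-distribˡ-+ α (F 0 k) _))

Conv-∑ : ∀ k {A : Set} (xs : List A) (F : A → ℕ → ℕ → ℤ) →
         Conv k (λ a b → ∑ xs (λ x → F x a b)) ≡ ∑ xs (λ x → Conv k (F x))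
Conv-∑ zero    xs F = sym (∑-zero xs)
Conv-∑ (suc k) xs F = trans (cong (∑ xs (λ x → F x 0 k) ⊕_) (Conv-∑ k xs (λ x a → F x (suc a))))
                            (sym (∑-+ xs (λ x → F x 0 k) (λ x → Conv k (λ a → F x (suc a)))))

Conv-last : ∀ k (F : ℕ → ℕ → ℤ) → Conv (suc k) F ≡ F k 0 ⊕ Conv k (λ a b → F a (suc b))
Conv-last zero    F = refl
Conv-last (suc k) F = trans (cong (F 0 (suc k) ⊕_) (Conv-last k (λ a → F (suc a))))
                            (+-left-comm (F 0 (suc k)) (F (suc k) 0) _)

Conv-sym : ∀ k (F : ℕ → ℕ → ℤ) → Conv k F ≡ Conv k (λ a b → F b a)
Conv-sym zero    F = refl
Conv-sym (suc k) F = trans (cong (F 0 k ⊕_) (Conv-sym k (λ a → F (suc a))))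
                           (sym (Conv-last k (λ a b → F b a)))

module FirstReturnAlgebra
  (ρ : ℤ) (c : ℕ → ℤ) (c-zero : c 0 ≡ 1ℤ ⊕ ρ) (c-suc : ∀ a → c (suc a) ≡ ρ)
  (s : ℕ → ℤ) (s-zero : s 0 ≡ 1ℤ)
  (s-rec : ∀ k → s (suc k) ≡ Conv k (λ a b → c a ⊛ (s a ⊛ s b)))
  where

  pairs : ℕ → ℤ
  pairs k = Conv k (λ a b → s a ⊛ s b)

  Conv-c : ∀ m (F : ℕ → ℕ → ℤ) → Conv (suc m) (λ a b → c a ⊛ F a b) ≡ ρ ⊛ Conv (suc m) F ⊕ F 0 m
  Conv-c m F = begin
      c 0 ⊛ F 0 m ⊕ Conv m (λ a b → c (suc a) ⊛ F (suc a) b)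
    ≡⟨ cong₂ (λ x y → x ⊛ F 0 m ⊕ y) c-zero
         (trans (Conv-cong m (λ a b → cong (_⊛ F (suc a) b) (c-suc a))) (Conv-*ˡ m ρ (λ a → F (suc a)))) ⟩
      (1ℤ ⊕ ρ) ⊛ F 0 m ⊕ ρ ⊛ Conv m (λ a → F (suc a))
    ≡⟨ ring-step ρ (F 0 m) (Conv m (λ a → F (suc a))) ⟩
      ρ ⊛ Conv (suc m) F ⊕ F 0 m
    ∎
    where
    open ≡-Reasoning
    ring-step : ∀ ρ x y → (1ℤ ⊕ ρ) ⊛ x ⊕ ρ ⊛ y ≡ ρ ⊛ (x ⊕ y) ⊕ x
    ring-step ρ x y = solve (ρ ∷ x ∷ y ∷ [])

  s-one : s 1 ≡ 0ℤ
  s-one = s-rec 0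

  s-step : ∀ m → s (suc (suc m)) ≡ s m ⊕ ρ ⊛ pairs (suc m)
  s-step m = begin
      s (suc (suc m))
    ≡⟨ s-rec (suc m) ⟩
      Conv (suc m) (λ a b → c a ⊛ (s a ⊛ s b))
    ≡⟨ Conv-c m (λ a b → s a ⊛ s b) ⟩
      ρ ⊛ pairs (suc m) ⊕ s 0 ⊛ s m
    ≡⟨ cong (λ x → ρ ⊛ pairs (suc m) ⊕ x ⊛ s m) s-zero ⟩
      ρ ⊛ pairs (suc m) ⊕ 1ℤ ⊛ s m
    ≡⟨ trans (cong (ρ ⊛ pairs (suc m) ⊕_) (ℤ.*-identityˡ (s m))) (ℤ.+-comm _ (s m)) ⟩
      s m ⊕ ρ ⊛ pairs (suc m)
    ∎
    where open ≡-Reasoning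

  Conv-collect : ∀ k (α : ℤ) (X Y : ℕ → ℤ) →
    Conv k (λ a b → α ⊛ (s a ⊛ s b) ⊕ (Y a ⊛ s b ⊕ s a ⊛ X b))
      ≡ α ⊛ pairs k ⊕ Conv k (λ a b → (Y a ⊕ X a) ⊛ s b)
  Conv-collect k α X Y = begin
      Conv k (λ a b → α ⊛ (s a ⊛ s b) ⊕ (Y a ⊛ s b ⊕ s a ⊛ X b))
    ≡⟨ Conv-+ k (λ a b → α ⊛ (s a ⊛ s b)) (λ a b → Y a ⊛ s b ⊕ s a ⊛ X b) ⟩
      Conv k (λ a b → α ⊛ (s a ⊛ s b)) ⊕ Conv k (λ a b → Y a ⊛ s b ⊕ s a ⊛ X b)
    ≡⟨ cong₂ _⊕_ (Conv-*ˡ k α (λ a b → s a ⊛ s b))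
         (trans (Conv-+ k (λ a b → Y a ⊛ s b) (λ a b → s a ⊛ X b))
                (cong (Conv k (λ a b → Y a ⊛ s b) ⊕_)
                      (trans (Conv-sym k (λ a b → s a ⊛ X b)) (Conv-cong k (λ a b → ℤ.*-comm (s b) (X a)))))) ⟩
      α ⊛ pairs k ⊕ (Conv k (λ a b → Y a ⊛ s b) ⊕ Conv k (λ a b → X a ⊛ s b))
    ≡⟨ cong (α ⊛ pairs k ⊕_)
         (trans (sym (Conv-+ k (λ a b → Y a ⊛ s b) (λ a b → X a ⊛ s b)))
                (Conv-cong k (λ a b → sym (ℤ.*-distribʳ-+ (s b) (Y a) (X a))))) ⟩
      α ⊛ pairs k ⊕ Conv k (λ a b → (Y a ⊕ X a) ⊛ s b)
    ∎
    where open ≡-Reasoning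

  -- X k totals an additive statistic over the paths of length k; on u P d Q it is α on the
  -- first step, plus a statistic with total Y on P (which sits one level up), plus X on Q.
  statistic-step : (α : ℤ) (X Y : ℕ → ℤ) → Y 0 ≡ 0ℤ →
    (∀ k → X (suc k) ≡ Conv k (λ a b → c a ⊛ (α ⊛ (s a ⊛ s b) ⊕ (Y a ⊛ s b ⊕ s a ⊛ X b)))) →
    ∀ m → X (suc (suc m)) ≡ X m ⊕ α ⊛ s (suc (suc m)) ⊕ ρ ⊛ Conv (suc m) (λ a b → (Y a ⊕ X a) ⊛ s b)
  statistic-step α X Y Y-zero X-rec m = begin
      X (suc (suc m))
    ≡⟨ X-rec (suc m) ⟩
      Conv (suc m) (λ a b → c a ⊛ G a b)
    ≡⟨ Conv-c m G ⟩
      ρ ⊛ Conv (suc m) G ⊕ G 0 m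
    ≡⟨ cong₂ (λ x y → ρ ⊛ x ⊕ y) (Conv-collect (suc m) α X Y) G-zero ⟩
      ρ ⊛ (α ⊛ pairs (suc m) ⊕ C) ⊕ (α ⊛ s m ⊕ X m)
    ≡⟨ ring-step ρ α (pairs (suc m)) C (s m) (X m) ⟩
      X m ⊕ α ⊛ (s m ⊕ ρ ⊛ pairs (suc m)) ⊕ ρ ⊛ C
    ≡⟨ cong (λ x → X m ⊕ α ⊛ x ⊕ ρ ⊛ C) (sym (s-step m)) ⟩
      X m ⊕ α ⊛ s (suc (suc m)) ⊕ ρ ⊛ C
    ∎
    where
    open ≡-Reasoning
    G : ℕ → ℕ → ℤ
    G a b = α ⊛ (s a ⊛ s b) ⊕ (Y a ⊛ s b ⊕ s a ⊛ X b)
    C : ℤ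
    C = Conv (suc m) (λ a b → (Y a ⊕ X a) ⊛ s b)
    ring-step : ∀ ρ α p C s x → ρ ⊛ (α ⊛ p ⊕ C) ⊕ (α ⊛ s ⊕ x) ≡ x ⊕ α ⊛ (s ⊕ ρ ⊛ p) ⊕ ρ ⊛ C
    ring-step ρ α p C s x = solve (ρ ∷ α ∷ p ∷ C ∷ s ∷ x ∷ [])
    unit : ∀ α y x → α ⊛ (1ℤ ⊛ y) ⊕ (0ℤ ⊛ y ⊕ 1ℤ ⊛ x) ≡ α ⊛ y ⊕ x
    unit α y x = solve (α ∷ y ∷ x ∷ [])
    G-zero : G 0 m ≡ α ⊛ s m ⊕ X m
    G-zero = trans (cong₂ (λ i y → α ⊛ (i ⊛ s m) ⊕ (y ⊛ s m ⊕ i ⊛ X m)) s-zero Y-zero) (unit α (s m) (X m))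

  module _ (N W : ℕ → ℤ) (N-zero : N 0 ≡ 0ℤ) (N-one : N 1 ≡ 0ℤ) (W-zero : W 0 ≡ 0ℤ)
    (N-step : ∀ m → N (suc (suc m)) ≡ N m ⊕ s (suc (suc m)))
    (W-step : ∀ m → W (suc (suc m)) ≡ W m ⊕ (s (suc (suc m)) - ρ ⊛ Conv (suc m) (λ a b → N a ⊛ s b)))
    where

    private
      M : ℕ → ℤ
      M k = Conv k (λ a b → N a ⊛ s b)

      -- E m = W (m + 2) − W m, by W-step.
      E : ℕ → ℤ
      E m = s (suc (suc m)) - ρ ⊛ M (suc m)

      t : ℕ → ℤ
      t j = s (j + j)

      even-suc : ∀ j → suc j + suc j ≡ suc (suc (j + j))
      even-suc j = cong suc (ℕ.+-suc j j)

    M-step : ∀ m → M (suc (suc m)) ≡ M m ⊕ (pairs (suc (suc m)) - s (suc m))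
    M-step m = begin
        N 0 ⊛ s (suc m) ⊕ (N 1 ⊛ s m ⊕ Conv m (λ a b → N (suc (suc a)) ⊛ s b))
      ≡⟨ cong₂ (λ x y → x ⊛ s (suc m) ⊕ (y ⊛ s m ⊕ Conv m (λ a b → N (suc (suc a)) ⊛ s b)))
               N-zero N-one ⟩
        0ℤ ⊛ s (suc m) ⊕ (0ℤ ⊛ s m ⊕ Conv m (λ a b → N (suc (suc a)) ⊛ s b))
      ≡⟨ cong (λ x → 0ℤ ⊛ s (suc m) ⊕ (0ℤ ⊛ s m ⊕ x)) shifted ⟩
        0ℤ ⊛ s (suc m) ⊕ (0ℤ ⊛ s m ⊕ (M m ⊕ R))
      ≡⟨ ring-step (s (suc m)) (s m) (M m) R ⟩
        M m ⊕ ((1ℤ ⊛ s (suc m) ⊕ (0ℤ ⊛ s m ⊕ R)) - s (suc m))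
      ≡⟨ cong₂ (λ x y → M m ⊕ ((x ⊛ s (suc m) ⊕ (y ⊛ s m ⊕ R)) - s (suc m))) (sym s-zero) (sym s-one) ⟩
        M m ⊕ (pairs (suc (suc m)) - s (suc m))
      ∎
      where
      open ≡-Reasoning
      R : ℤ
      R = Conv m (λ a b → s (suc (suc a)) ⊛ s b)
      shifted : Conv m (λ a b → N (suc (suc a)) ⊛ s b) ≡ M m ⊕ R
      shifted = trans (Conv-cong m (λ a b → trans (cong (_⊛ s b) (N-step a)) (ℤ.*-distribʳ-+ (s b) (N a) _)))
                      (Conv-+ m (λ a b → N a ⊛ s b) (λ a b → s (suc (suc a)) ⊛ s b))
      ring-step : ∀ y x m r → 0ℤ ⊛ y ⊕ (0ℤ ⊛ x ⊕ (m ⊕ r)) ≡ m ⊕ ((1ℤ ⊛ y ⊕ (0ℤ ⊛ x ⊕ r)) - y)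
      ring-step y x m r = solve (y ∷ x ∷ m ∷ r ∷ [])

    E-step : ∀ m → E (suc (suc m)) ≡ E m ⊕ ρ ⊛ s (suc (suc m))
    E-step m = trans (cong₂ (λ x y → x - ρ ⊛ y) (s-step (suc (suc m))) (M-step (suc m)))
                     (ring-step (s (suc (suc m))) ρ (pairs (suc (suc (suc m)))) (M (suc m)))
      where
      ring-step : ∀ s ρ p m → (s ⊕ ρ ⊛ p) - ρ ⊛ (m ⊕ (p - s)) ≡ (s - ρ ⊛ m) ⊕ ρ ⊛ s
      ring-step s ρ p m = solve (s ∷ ρ ∷ p ∷ m ∷ [])

    E-zero : E 0 ≡ 1ℤ ⊕ ρ
    E-zero = begin
        s 2 - ρ ⊛ (N 0 ⊛ s 0 ⊕ 0ℤ)
      ≡⟨ cong₂ (λ x y → x - ρ ⊛ (y ⊛ s 0 ⊕ 0ℤ)) (s-step 0) N-zero ⟩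
        (s 0 ⊕ ρ ⊛ (s 0 ⊛ s 0 ⊕ 0ℤ)) - ρ ⊛ (0ℤ ⊛ s 0 ⊕ 0ℤ)
      ≡⟨ cong (λ x → (x ⊕ ρ ⊛ (x ⊛ x ⊕ 0ℤ)) - ρ ⊛ (0ℤ ⊛ x ⊕ 0ℤ)) s-zero ⟩
        (1ℤ ⊕ ρ ⊛ (1ℤ ⊛ 1ℤ ⊕ 0ℤ)) - ρ ⊛ (0ℤ ⊛ 1ℤ ⊕ 0ℤ)
      ≡⟨ ring-step ρ ⟩
        1ℤ ⊕ ρ
      ∎
      where
      open ≡-Reasoning
      ring-step : ∀ ρ → (1ℤ ⊕ ρ ⊛ (1ℤ ⊛ 1ℤ ⊕ 0ℤ)) - ρ ⊛ (0ℤ ⊛ 1ℤ ⊕ 0ℤ) ≡ 1ℤ ⊕ ρ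
      ring-step ρ = solve (ρ ∷ [])

    E-even : ∀ j → E (j + j) ≡ 1ℤ ⊕ ρ ⊛ Σℤ j (λ ℓ → t (j ∸ ℓ))
    E-even zero = trans E-zero (trans (ring-step ρ) (cong (λ x → 1ℤ ⊕ ρ ⊛ (x ⊕ 0ℤ)) (sym s-zero)))
      where
      ring-step : ∀ ρ → 1ℤ ⊕ ρ ≡ 1ℤ ⊕ ρ ⊛ (1ℤ ⊕ 0ℤ)
      ring-step ρ = solve (ρ ∷ [])
    E-even (suc j) = begin
        E (suc j + suc j)
      ≡⟨ cong E (even-suc j) ⟩
        E (suc (suc (j + j)))
      ≡⟨ E-step (j + j) ⟩
        E (j + j) ⊕ ρ ⊛ s (suc (suc (j + j)))
      ≡⟨ cong₂ _⊕_ (E-even j) (cong (λ k → ρ ⊛ s k) (sym (even-suc j))) ⟩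
        1ℤ ⊕ ρ ⊛ Σℤ j (λ ℓ → t (j ∸ ℓ)) ⊕ ρ ⊛ t (suc j)
      ≡⟨ ring-step ρ (Σℤ j (λ ℓ → t (j ∸ ℓ))) (t (suc j)) ⟩
        1ℤ ⊕ ρ ⊛ (t (suc j) ⊕ Σℤ j (λ ℓ → t (j ∸ ℓ)))
      ≡⟨ cong (λ x → 1ℤ ⊕ ρ ⊛ x) (sym (Σℤ-peel j (λ ℓ → t (suc j ∸ ℓ)))) ⟩
        1ℤ ⊕ ρ ⊛ Σℤ (suc j) (λ ℓ → t (suc j ∸ ℓ))
      ∎
      where
      open ≡-Reasoning
      ring-step : ∀ ρ q x → 1ℤ ⊕ ρ ⊛ q ⊕ ρ ⊛ x ≡ 1ℤ ⊕ ρ ⊛ (x ⊕ q)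
      ring-step ρ q x = solve (ρ ∷ q ∷ x ∷ [])

    W-even : ∀ n → W (suc n + suc n) ≡ + suc n ⊕ ρ ⊛ Σℤ n (λ ℓ → + suc ℓ ⊛ t (n ∸ ℓ))
    W-even zero = begin
        W 2
      ≡⟨ W-step 0 ⟩
        W 0 ⊕ E 0
      ≡⟨ cong₂ _⊕_ W-zero E-zero ⟩
        0ℤ ⊕ (1ℤ ⊕ ρ)
      ≡⟨ ring-step ρ ⟩
        1ℤ ⊕ ρ ⊛ (1ℤ ⊛ 1ℤ ⊕ 0ℤ)
      ≡⟨ cong (λ x → 1ℤ ⊕ ρ ⊛ (1ℤ ⊛ x ⊕ 0ℤ)) (sym s-zero) ⟩
        1ℤ ⊕ ρ ⊛ (1ℤ ⊛ s 0 ⊕ 0ℤ)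
      ∎
      where
      open ≡-Reasoning
      ring-step : ∀ ρ → 0ℤ ⊕ (1ℤ ⊕ ρ) ≡ 1ℤ ⊕ ρ ⊛ (1ℤ ⊛ 1ℤ ⊕ 0ℤ)
      ring-step ρ = solve (ρ ∷ [])
    W-even (suc n) = begin
        W (suc (suc n) + suc (suc n))
      ≡⟨ cong W (even-suc (suc n)) ⟩
        W (suc (suc (suc n + suc n)))
      ≡⟨ W-step (suc n + suc n) ⟩
        W (suc n + suc n) ⊕ E (suc n + suc n)
      ≡⟨ cong₂ _⊕_ (W-even n) (E-even (suc n)) ⟩
        (+ suc n ⊕ ρ ⊛ T) ⊕ (1ℤ ⊕ ρ ⊛ Q)
      ≡⟨ ring-step (+ suc n) ρ T Q ⟩
        1ℤ ⊕ + suc n ⊕ ρ ⊛ (T ⊕ Q)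
      ≡⟨ cong (λ x → 1ℤ ⊕ + suc n ⊕ ρ ⊛ x) (sym (Σℤ-weighted-peel n t)) ⟩
        + suc (suc n) ⊕ ρ ⊛ Σℤ (suc n) (λ ℓ → + suc ℓ ⊛ t (suc n ∸ ℓ))
      ∎
      where
      open ≡-Reasoning
      T Q : ℤ
      T = Σℤ n (λ ℓ → + suc ℓ ⊛ t (n ∸ ℓ))
      Q = Σℤ (suc n) (λ ℓ → t (suc n ∸ ℓ))
      ring-step : ∀ k ρ x y → (k ⊕ ρ ⊛ x) ⊕ (1ℤ ⊕ ρ ⊛ y) ≡ 1ℤ ⊕ k ⊕ ρ ⊛ (x ⊕ y)
      ring-step k ρ x y = solve (k ∷ ρ ∷ x ∷ y ∷ [])

module ColouredPaths (r : ℕ) where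

  data Path : ℕ → ℕ → List (Step r) → Set where
    end  : Path 0 0 []
    up   : ∀ {k h p} → Path k (suc h) p → Path (suc k) h (u ∷ p)
    down : ∀ {k h p} c → Path k h p → Path (suc k) (suc h) (d c ∷ p)

  paths-sound : ∀ k h → All (Path k h) (paths r k h)
  paths-sound zero    zero    = end All.∷ All.[]
  paths-sound zero    (suc h) = All.[]
  paths-sound (suc k) zero    = All.map⁺ (All.map up (paths-sound k 1))
  paths-sound (suc k) (suc h) =
    All.++⁺ (All.map⁺ (All.map up (paths-sound k (suc (suc h)))))
            (All.concat⁺ (All.map⁺ (All.universal (λ c → All.map⁺ (All.map (down c) (paths-sound k h)))
                                                  (allFin r))))

  ∑-paths-from-zero : ∀ k (g : List (Step r) → ℤ) →
    ∑ (paths r (suc k) 0) g ≡ ∑ (paths r k 1) (λ p → g (u ∷ p))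
  ∑-paths-from-zero k g = ∑-map (u ∷_) (paths r k 1) g

  ∑-paths-from-suc : ∀ k h (g : List (Step r) → ℤ) →
    ∑ (paths r (suc k) (suc h)) g
      ≡ ∑ (paths r k (suc (suc h))) (λ p → g (u ∷ p))
          ⊕ ∑ (allFin r) (λ c → ∑ (paths r k h) (λ p → g (d c ∷ p)))
  ∑-paths-from-suc k h g =
    trans (∑-++ (map (u ∷_) (paths r k (suc (suc h)))) _ g)
          (cong₂ _⊕_ (∑-map (u ∷_) (paths r k (suc (suc h))) g)
                     (trans (∑-concatMap (λ c → map (d c ∷_) (paths r k h)) (allFin r) g)
                            (∑-cong (allFin r) (λ c → ∑-map (d c ∷_) (paths r k h) g))))

  -- Cut a path from height j + h + 1 at its first d-step down to height h; the part before
  -- it is a path from j to 0 lifted by h + 1.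
  paths-firstPassage : ∀ k j h (g : List (Step r) → ℤ) →
    ∑ (paths r k (suc (j + h))) g
      ≡ Conv k (λ a b → ∑ (paths r a j) (λ P →
                          ∑ (allFin r) (λ c → ∑ (paths r b h) (λ Q → g (P ++ d c ∷ Q)))))
  paths-firstPassage zero    j       h g = refl
  paths-firstPassage (suc m) zero    h g = begin
      ∑ (paths r (suc m) (suc h)) g
    ≡⟨ ∑-paths-from-suc m h g ⟩
      ∑ (paths r m (suc (suc h))) (λ p → g (u ∷ p)) ⊕ returnNow
    ≡⟨ cong (_⊕ returnNow) (paths-firstPassage m 1 h (λ p → g (u ∷ p))) ⟩
      Conv m (λ a b → ∑ (paths r a 1) (λ P → K (u ∷ P) b)) ⊕ returnNow
    ≡⟨ ℤ.+-comm _ returnNow ⟩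
      returnNow ⊕ Conv m (λ a b → ∑ (paths r a 1) (λ P → K (u ∷ P) b))
    ≡⟨ cong₂ _⊕_ (sym (ℤ.+-identityʳ returnNow))
                 (Conv-cong m (λ a b → sym (∑-paths-from-zero a (λ P → K P b)))) ⟩
      Conv (suc m) (λ a b → ∑ (paths r a 0) (λ P → K P b))
    ∎
    where
    open ≡-Reasoning
    K : List (Step r) → ℕ → ℤ
    K P b = ∑ (allFin r) (λ c → ∑ (paths r b h) (λ Q → g (P ++ d c ∷ Q)))
    returnNow : ℤ
    returnNow = K [] m
  paths-firstPassage (suc m) (suc j) h g = begin
      ∑ (paths r (suc m) (suc (suc (j + h)))) g
    ≡⟨ ∑-paths-from-suc m (suc (j + h)) g ⟩
      ∑ (paths r m (suc (suc (suc (j + h))))) (λ p → g (u ∷ p))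
        ⊕ ∑ (allFin r) (λ c′ → ∑ (paths r m (suc (j + h))) (λ p → g (d c′ ∷ p)))
    ≡⟨ cong₂ _⊕_ (paths-firstPassage m (suc (suc j)) h (λ p → g (u ∷ p)))
                 (∑-cong (allFin r) (λ c′ → paths-firstPassage m j h (λ p → g (d c′ ∷ p)))) ⟩
      Conv m (λ a b → ∑ (paths r a (suc (suc j))) (λ P → K (u ∷ P) b))
        ⊕ ∑ (allFin r) (λ c′ → Conv m (λ a b → ∑ (paths r a j) (λ P → K (d c′ ∷ P) b)))
    ≡⟨ cong (Conv m (λ a b → ∑ (paths r a (suc (suc j))) (λ P → K (u ∷ P) b)) ⊕_)
            (sym (Conv-∑ m (allFin r) (λ c′ a b → ∑ (paths r a j) (λ P → K (d c′ ∷ P) b)))) ⟩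
      Conv m (λ a b → ∑ (paths r a (suc (suc j))) (λ P → K (u ∷ P) b))
        ⊕ Conv m (λ a b → ∑ (allFin r) (λ c′ → ∑ (paths r a j) (λ P → K (d c′ ∷ P) b)))
    ≡⟨ sym (Conv-+ m _ _) ⟩
      Conv m (λ a b → ∑ (paths r a (suc (suc j))) (λ P → K (u ∷ P) b)
                        ⊕ ∑ (allFin r) (λ c′ → ∑ (paths r a j) (λ P → K (d c′ ∷ P) b)))
    ≡⟨ Conv-cong m (λ a b → sym (∑-paths-from-suc a j (λ P → K P b))) ⟩
      Conv m (λ a b → ∑ (paths r (suc a) (suc j)) (λ P → K P b))
    ≡⟨ sym (ℤ.+-identityˡ _) ⟩
      Conv (suc m) (λ a b → ∑ (paths r a (suc j)) (λ P → K P b))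
    ∎
    where
    open ≡-Reasoning
    K : List (Step r) → ℕ → ℤ
    K P b = ∑ (allFin r) (λ c → ∑ (paths r b h) (λ Q → g (P ++ d c ∷ Q)))

  allowedAfter : Maybe (Step r) → Fin r → Bool
  allowedAfter (just (d c′)) c = not ⌊ c′ Fin.≟ c ⌋
  allowedAfter _             c = true

  noSameDD-++ : ∀ P c Q →
    noSameDD (P ++ d c ∷ Q) ≡ noSameDD P ∧ (allowedAfter (last P) c ∧ noSameDD (d c ∷ Q))
  noSameDD-++ []               c Q = refl
  noSameDD-++ (u ∷ [])         c Q = refl
  noSameDD-++ (d a ∷ [])       c Q = refl
  noSameDD-++ (u ∷ y ∷ P)      c Q = noSameDD-++ (y ∷ P) c Q
  noSameDD-++ (d a ∷ u ∷ P)    c Q = noSameDD-++ (u ∷ P) c Q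
  noSameDD-++ (d a ∷ d b ∷ P)  c Q =
    trans (cong (not ⌊ a Fin.≟ b ⌋ ∧_) (noSameDD-++ (d b ∷ P) c Q))
          (sym (Bool.∧-assoc (not ⌊ a Fin.≟ b ⌋) _ _))

  noSameDD-return : ∀ {b} P c {Q} → Path b 0 Q →
    noSameDD (u ∷ P ++ d c ∷ Q) ≡ noSameDD P ∧ (allowedAfter (last P) c ∧ noSameDD Q)
  noSameDD-return P c end    = noSameDD-++ P c []
  noSameDD-return P c (up q) = noSameDD-++ P c (u ∷ _)

  last-down : ∀ {a h P} → Path (suc a) h P → Σ (Fin r) (λ c′ → last P ≡ just (d c′))
  last-down (up (up q))          = last-down (up q)
  last-down (up (down c q))      = last-down (down c q)
  last-down (down c end)         = c , refl
  last-down (down c (up q))      = last-down (up q)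
  last-down (down c (down c′ q)) = last-down (down c′ q)

  colourChoices : ℕ → ℤ
  colourChoices zero    = + r
  colourChoices (suc _) = + (r ∸ 1)

  allowedColours : ∀ {a h P} → Path a h P →
    ∑ (allFin r) (λ c → ⟦ allowedAfter (last P) c ⟧) ≡ colourChoices a
  allowedColours end = ∑-allFin-1 r
  allowedColours {suc a} q with last-down q
  ... | c′ , last≡ =
    trans (cong (λ x → ∑ (allFin r) (λ c → ⟦ allowedAfter x c ⟧)) last≡) (∑-allFin-≠ c′)

  -- A u-step starting at height ℓ is at level ℓ + 1.
  upHeights : ℕ → List (Step r) → List ℕ
  upHeights h []        = []
  upHeights h (u ∷ p)   = h ∷ upHeights (suc h) p
  upHeights h (d _ ∷ p) = upHeights (h ∸ 1) p

  uAtLevelFrom-upHeights : ∀ ℓ h p →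
    + uAtLevelFrom (suc ℓ) h p ≡ ∑ (upHeights h p) (λ x → + (if x ≡ᵇ ℓ then 1 else 0))
  uAtLevelFrom-upHeights ℓ h []        = refl
  uAtLevelFrom-upHeights ℓ h (u ∷ p)   =
    cong₂ (λ b y → + (if b then 1 else 0) ⊕ y)
          (isYes≗does (suc h ℕ.≟ suc ℓ)) (uAtLevelFrom-upHeights ℓ (suc h) p)
  uAtLevelFrom-upHeights ℓ h (d _ ∷ p) = uAtLevelFrom-upHeights ℓ (h ∸ 1) p

  upHeights-lift : ∀ {k j P} → Path k j P → ∀ R →
    upHeights (suc j) (P ++ R) ≡ map suc (upHeights j P) ++ upHeights 1 R
  upHeights-lift end        R = refl
  upHeights-lift (up q)     R = cong (_ ∷_) (upHeights-lift q R)
  upHeights-lift (down c q) R = upHeights-lift q R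

  height≤length : ∀ {k h p} → Path k h p → h ≤ k
  height≤length end        = z≤n
  height≤length (up q)     = ℕ.m≤n⇒m≤1+n (ℕ.<⇒≤ (height≤length q))
  height≤length (down c q) = s≤s (height≤length q)

  upHeights-bound : ∀ {k h p} → Path k h p → All (λ x → 2 + (x + x) ≤ h + k) (upHeights h p)
  upHeights-bound end = All.[]
  upHeights-bound {suc k} {h} (up q) =
    ℕ.≤-trans (ℕ.≤-reflexive (sym h+2+h)) (ℕ.+-monoʳ-≤ h (s≤s (height≤length q)))
      All.∷ All.map (λ bound → ℕ.≤-trans bound (ℕ.≤-reflexive (sym (ℕ.+-suc h k)))) (upHeights-bound q)
    where
    h+2+h : h + suc (suc h) ≡ 2 + (h + h)
    h+2+h = trans (ℕ.+-suc h (suc h)) (cong suc (ℕ.+-suc h h))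
  upHeights-bound {suc k} {suc h} (down c q) =
    All.map (λ bound → ℕ.≤-trans bound (ℕ.+-mono-≤ (ℕ.n≤1+n h) (ℕ.n≤1+n k))) (upHeights-bound q)

  -- 𝒜 indexed by length: A r n is validPaths (n + n).
  validPaths : ℕ → List (List (Step r))
  validPaths k = filter (λ p → noSameDD p Bool.≟ true) (paths r k 0)

  allUpHeights : ℕ → List ℕ
  allUpHeights k = concatMap (upHeights 0) (validPaths k)

  allUpHeights-bound : ∀ k → All (λ x → 2 + (x + x) ≤ k) (allUpHeights k)
  allUpHeights-bound k =
    All.concat⁺ (All.map⁺ (All.filter⁺ (λ p → noSameDD p Bool.≟ true)
                                       (All.map upHeights-bound (paths-sound k 0))))

  validCount : ℕ → ℤ
  validCount k = ∑ (validPaths k) (λ _ → 1ℤ)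

  returnHeights : List (Step r) → List (Step r) → List ℕ
  returnHeights P Q = 0 ∷ map suc (upHeights 0 P) ++ upHeights 0 Q

  upHeights-return : ∀ {a P} → Path a 0 P → ∀ c Q → upHeights 0 (u ∷ P ++ d c ∷ Q) ≡ returnHeights P Q
  upHeights-return q c Q = cong (0 ∷_) (upHeights-lift q (d c ∷ Q))

  returnColourings : ∀ {a} b {P} → Path a 0 P → (Φ : List ℕ → ℤ) →
    ∑ (allFin r) (λ c → ∑ (paths r b 0) (λ Q →
      ⟦ noSameDD (u ∷ P ++ d c ∷ Q) ⟧ ⊛ Φ (upHeights 0 (u ∷ P ++ d c ∷ Q))))
      ≡ colourChoices a ⊛ (⟦ noSameDD P ⟧ ⊛ ∑ (validPaths b) (λ Q → Φ (returnHeights P Q)))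
  returnColourings {a} b {P} q Φ = begin
      ∑ (allFin r) (λ c → ∑ (paths r b 0) (λ Q →
        ⟦ noSameDD (u ∷ P ++ d c ∷ Q) ⟧ ⊛ Φ (upHeights 0 (u ∷ P ++ d c ∷ Q))))
    ≡⟨ ∑-cong (allFin r) (λ c → ∑-congᴬ (All.map (split c) (paths-sound b 0))) ⟩
      ∑ (allFin r) (λ c → ∑ (paths r b 0) (λ Q → allowed c ⊛ Y Q))
    ≡⟨ ∑-cong (allFin r) (λ c → ∑-*ˡ (allowed c) (paths r b 0) Y) ⟩
      ∑ (allFin r) (λ c → allowed c ⊛ ∑ (paths r b 0) Y)
    ≡⟨ ∑-*ʳ (∑ (paths r b 0) Y) (allFin r) allowed ⟩
      ∑ (allFin r) allowed ⊛ ∑ (paths r b 0) Y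
    ≡⟨ cong₂ _⊛_ (trans (∑-*ˡ ⟦ noSameDD P ⟧ (allFin r) _) (cong (⟦ noSameDD P ⟧ ⊛_) (allowedColours q)))
                 (sym (∑-filter noSameDD (paths r b 0) (λ Q → Φ (returnHeights P Q)))) ⟩
      (⟦ noSameDD P ⟧ ⊛ colourChoices a) ⊛ Z
    ≡⟨ left-comm-* ⟦ noSameDD P ⟧ (colourChoices a) Z ⟩
      colourChoices a ⊛ (⟦ noSameDD P ⟧ ⊛ Z)
    ∎
    where
    open ≡-Reasoning
    allowed : Fin r → ℤ
    allowed c = ⟦ noSameDD P ⟧ ⊛ ⟦ allowedAfter (last P) c ⟧
    Y : List (Step r) → ℤ
    Y Q = ⟦ noSameDD Q ⟧ ⊛ Φ (returnHeights P Q)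
    Z : ℤ
    Z = ∑ (validPaths b) (λ Q → Φ (returnHeights P Q))
    left-comm-* : ∀ x y z → (x ⊛ y) ⊛ z ≡ y ⊛ (x ⊛ z)
    left-comm-* x y z = solve (x ∷ y ∷ z ∷ [])
    regroup : ∀ x y z w → (x ⊛ (y ⊛ z)) ⊛ w ≡ (x ⊛ y) ⊛ (z ⊛ w)
    regroup x y z w = solve (x ∷ y ∷ z ∷ w ∷ [])
    split : ∀ c {Q} → Path b 0 Q →
      ⟦ noSameDD (u ∷ P ++ d c ∷ Q) ⟧ ⊛ Φ (upHeights 0 (u ∷ P ++ d c ∷ Q)) ≡ allowed c ⊛ Y Q
    split c {Q} q′ = begin
        ⟦ noSameDD (u ∷ P ++ d c ∷ Q) ⟧ ⊛ Φ (upHeights 0 (u ∷ P ++ d c ∷ Q))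
      ≡⟨ cong₂ _⊛_ (trans (cong ⟦_⟧ (noSameDD-return P c q′))
                          (trans (⟦∧⟧ (noSameDD P) _)
                                 (cong (⟦ noSameDD P ⟧ ⊛_) (⟦∧⟧ (allowedAfter (last P) c) (noSameDD Q)))))
                   (cong Φ (upHeights-return q c Q)) ⟩
        (⟦ noSameDD P ⟧ ⊛ (⟦ allowedAfter (last P) c ⟧ ⊛ ⟦ noSameDD Q ⟧)) ⊛ Φ (returnHeights P Q)
      ≡⟨ regroup ⟦ noSameDD P ⟧ ⟦ allowedAfter (last P) c ⟧ ⟦ noSameDD Q ⟧ (Φ (returnHeights P Q)) ⟩
        allowed c ⊛ Y Q
      ∎

  validPaths-firstReturn : ∀ k (Φ : List ℕ → ℤ) →
    ∑ (validPaths (suc k)) (λ p → Φ (upHeights 0 p))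
      ≡ Conv k (λ a b → colourChoices a ⊛ ∑ (validPaths a) (λ P →
                          ∑ (validPaths b) (λ Q → Φ (returnHeights P Q))))
  validPaths-firstReturn k Φ = begin
      ∑ (validPaths (suc k)) (λ p → Φ (upHeights 0 p))
    ≡⟨ ∑-filter noSameDD (paths r (suc k) 0) _ ⟩
      ∑ (paths r (suc k) 0) g
    ≡⟨ ∑-paths-from-zero k g ⟩
      ∑ (paths r k 1) (λ p → g (u ∷ p))
    ≡⟨ paths-firstPassage k 0 0 (λ p → g (u ∷ p)) ⟩
      Conv k (λ a b → ∑ (paths r a 0) (λ P →
                        ∑ (allFin r) (λ c → ∑ (paths r b 0) (λ Q → g (u ∷ P ++ d c ∷ Q)))))
    ≡⟨ Conv-cong k arches ⟩
      Conv k (λ a b → colourChoices a ⊛ ∑ (validPaths a) (λ P → ∑ (validPaths b) (λ Q → Φ (returnHeights P Q))))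
    ∎
    where
    open ≡-Reasoning
    g : List (Step r) → ℤ
    g p = ⟦ noSameDD p ⟧ ⊛ Φ (upHeights 0 p)
    arches : ∀ a b →
      ∑ (paths r a 0) (λ P → ∑ (allFin r) (λ c → ∑ (paths r b 0) (λ Q → g (u ∷ P ++ d c ∷ Q))))
        ≡ colourChoices a ⊛ ∑ (validPaths a) (λ P → ∑ (validPaths b) (λ Q → Φ (returnHeights P Q)))
    arches a b = begin
        ∑ (paths r a 0) (λ P → ∑ (allFin r) (λ c → ∑ (paths r b 0) (λ Q → g (u ∷ P ++ d c ∷ Q))))
      ≡⟨ ∑-congᴬ (All.map (λ q → returnColourings b q Φ) (paths-sound a 0)) ⟩
        ∑ (paths r a 0) (λ P → colourChoices a ⊛ (⟦ noSameDD P ⟧ ⊛ Z P))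
      ≡⟨ ∑-*ˡ (colourChoices a) (paths r a 0) (λ P → ⟦ noSameDD P ⟧ ⊛ Z P) ⟩
        colourChoices a ⊛ ∑ (paths r a 0) (λ P → ⟦ noSameDD P ⟧ ⊛ Z P)
      ≡⟨ cong (colourChoices a ⊛_) (sym (∑-filter noSameDD (paths r a 0) Z)) ⟩
        colourChoices a ⊛ ∑ (validPaths a) Z
      ∎
      where
      Z : List (Step r) → ℤ
      Z P = ∑ (validPaths b) (λ Q → Φ (returnHeights P Q))

  validCount-rec : ∀ k → validCount (suc k) ≡ Conv k (λ a b → colourChoices a ⊛ (validCount a ⊛ validCount b))
  validCount-rec k = trans (validPaths-firstReturn k (λ _ → 1ℤ))
    (Conv-cong k (λ a b → cong (colourChoices a ⊛_)
      (trans (∑-const (validPaths a) (validCount b)) (ℤ.*-comm (validCount b) (validCount a)))))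

  ∑-returnHeights : ∀ (f : ℕ → ℤ) P Q →
    ∑ (returnHeights P Q) f ≡ (f 0 ⊕ ∑ (upHeights 0 P) (λ x → f (suc x))) ⊕ ∑ (upHeights 0 Q) f
  ∑-returnHeights f P Q =
    trans (cong (f 0 ⊕_) (trans (∑-++ (map suc (upHeights 0 P)) (upHeights 0 Q) f)
                                (cong (_⊕ ∑ (upHeights 0 Q) f) (∑-map suc (upHeights 0 P) f))))
          (sym (ℤ.+-assoc (f 0) _ _))

  returnHeights-total : ∀ a b (f : ℕ → ℤ) →
    ∑ (validPaths a) (λ P → ∑ (validPaths b) (λ Q → ∑ (returnHeights P Q) f))
      ≡ f 0 ⊛ (validCount a ⊛ validCount b)
          ⊕ (∑ (allUpHeights a) (λ x → f (suc x)) ⊛ validCount b ⊕ validCount a ⊛ ∑ (allUpHeights b) f)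
  returnHeights-total a b f = begin
      ∑ (validPaths a) (λ P → ∑ (validPaths b) (λ Q → ∑ (returnHeights P Q) f))
    ≡⟨ ∑-cong (validPaths a) (λ P → ∑-cong (validPaths b) (∑-returnHeights f P)) ⟩
      ∑ (validPaths a) (λ P → ∑ (validPaths b) (λ Q → X P ⊕ ∑ (upHeights 0 Q) f))
    ≡⟨ ∑-∑-+ (validPaths a) (validPaths b) X (λ Q → ∑ (upHeights 0 Q) f) ⟩
      ∑ (validPaths a) X ⊛ validCount b ⊕ validCount a ⊛ ∑ (validPaths b) (λ Q → ∑ (upHeights 0 Q) f)
    ≡⟨ cong₂ (λ x y → x ⊛ validCount b ⊕ validCount a ⊛ y)
         (trans (∑-+ (validPaths a) (λ _ → f 0) (λ P → ∑ (upHeights 0 P) (λ x → f (suc x))))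
                (cong₂ _⊕_ (∑-const (validPaths a) (f 0))
                           (sym (∑-concatMap (upHeights 0) (validPaths a) (λ x → f (suc x))))))
         (sym (∑-concatMap (upHeights 0) (validPaths b) f)) ⟩
      (f 0 ⊛ validCount a ⊕ Lifted) ⊛ validCount b ⊕ validCount a ⊛ ∑ (allUpHeights b) f
    ≡⟨ rearrange (f 0) (validCount a) (validCount b) Lifted (∑ (allUpHeights b) f) ⟩
      f 0 ⊛ (validCount a ⊛ validCount b) ⊕ (Lifted ⊛ validCount b ⊕ validCount a ⊛ ∑ (allUpHeights b) f)
    ∎
    where
    open ≡-Reasoning
    X : List (Step r) → ℤ
    X P = f 0 ⊕ ∑ (upHeights 0 P) (λ x → f (suc x))
    Lifted : ℤ
    Lifted = ∑ (allUpHeights a) (λ x → f (suc x))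
    rearrange : ∀ φ a b x y → (φ ⊛ a ⊕ x) ⊛ b ⊕ a ⊛ y ≡ φ ⊛ (a ⊛ b) ⊕ (x ⊛ b ⊕ a ⊛ y)
    rearrange φ a b x y = solve (φ ∷ a ∷ b ∷ x ∷ y ∷ [])

  allUpHeights-rec : ∀ k (f : ℕ → ℤ) →
    ∑ (allUpHeights (suc k)) f
      ≡ Conv k (λ a b → colourChoices a ⊛ (f 0 ⊛ (validCount a ⊛ validCount b)
                          ⊕ (∑ (allUpHeights a) (λ x → f (suc x)) ⊛ validCount b
                             ⊕ validCount a ⊛ ∑ (allUpHeights b) f)))
  allUpHeights-rec k f =
    trans (∑-concatMap (upHeights 0) (validPaths (suc k)) f)
          (trans (validPaths-firstReturn k (λ hs → ∑ hs f))
                 (Conv-cong k (λ a b → cong (colourChoices a ⊛_) (returnHeights-total a b f))))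

  alternatingUpSum : ∀ n →
    Σℤ n (λ ℓ → sign ℓ ℤ.* (+ (suc ℓ * U r n ℓ)))
      ≡ ∑ (allUpHeights (suc n + suc n)) (λ x → sign x ⊛ + suc x)
  alternatingUpSum n = begin
      Σℤ n (λ ℓ → sign ℓ ⊛ + (suc ℓ * U r n ℓ))
    ≡⟨ ∑-cong (upTo (suc n)) (λ ℓ →
         trans (cong (sign ℓ ⊛_) (trans (ℤ.pos-* (suc ℓ) (U r n ℓ)) (cong (+ suc ℓ ⊛_) (U≡ ℓ))))
               (sym (ℤ.*-assoc (sign ℓ) (+ suc ℓ) _))) ⟩
      Σℤ n (λ ℓ → w ℓ ⊛ ∑ H (δ ℓ))
    ≡⟨ ∑-cong (upTo (suc n)) (λ ℓ → sym (∑-*ˡ (w ℓ) H (δ ℓ))) ⟩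
      Σℤ n (λ ℓ → ∑ H (λ x → w ℓ ⊛ δ ℓ x))
    ≡⟨ ∑-swap (upTo (suc n)) H (λ ℓ x → w ℓ ⊛ δ ℓ x) ⟩
      ∑ H (λ x → Σℤ n (λ ℓ → w ℓ ⊛ δ ℓ x))
    ≡⟨ ∑-congᴬ (All.map (λ {x} bound → Σℤ-δ {x} (departs≤n bound) w) (allUpHeights-bound K)) ⟩
      ∑ H w
    ∎
    where
    open ≡-Reasoning
    K : ℕ
    K = suc n + suc n
    H : List ℕ
    H = allUpHeights K
    w : ℕ → ℤ
    w x = sign x ⊛ + suc x
    δ : ℕ → ℕ → ℤ
    δ ℓ x = + (if x ≡ᵇ ℓ then 1 else 0)
    U≡ : ∀ ℓ → + U r n ℓ ≡ ∑ H (δ ℓ)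
    U≡ ℓ = trans (+-sum (uAtLevel (suc ℓ)) (validPaths K))
                 (trans (∑-cong (validPaths K) (uAtLevelFrom-upHeights ℓ 0))
                        (sym (∑-concatMap (upHeights 0) (validPaths K) (δ ℓ))))
    departs≤n : ∀ {x} → 2 + (x + x) ≤ K → x ≤ n
    departs≤n {x} bound = ℕ.≮⇒≥ (λ n<x → ℕ.<⇒≱ (ℕ.+-mono-< n<x n<x) x+x≤n+n)
      where
      x+x≤n+n : x + x ≤ n + n
      x+x≤n+n = s≤s⁻¹ (s≤s⁻¹ (ℕ.≤-trans bound (ℕ.≤-reflexive (cong suc (ℕ.+-suc n n)))))

  weightedCounts : ∀ n →
    + Σℕ n (λ ℓ → suc ℓ * S r (n ∸ ℓ))
      ≡ Σℤ n (λ ℓ → + suc ℓ ⊛ validCount ((n ∸ ℓ) + (n ∸ ℓ)))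
  weightedCounts n = trans (+-sum (λ ℓ → suc ℓ * S r (n ∸ ℓ)) (upTo (suc n)))
    (∑-cong (upTo (suc n)) (λ ℓ → trans (ℤ.pos-* (suc ℓ) (S r (n ∸ ℓ)))
                                        (cong (+ suc ℓ ⊛_) (+-length (validPaths ((n ∸ ℓ) + (n ∸ ℓ)))))))

module _ (q : ℕ) where
  open ColouredPaths (suc q)
  open FirstReturnAlgebra (+ q) colourChoices refl (λ _ → refl) validCount refl validCount-rec

  private
    w N W : ℕ → ℤ
    w x = sign x ⊛ + suc x
    N k = ∑ (allUpHeights k) sign
    W k = ∑ (allUpHeights k) w

  allUpHeights-step : ∀ (f : ℕ → ℤ) m →
    ∑ (allUpHeights (suc (suc m))) f
      ≡ ∑ (allUpHeights m) f ⊕ f 0 ⊛ validCount (suc (suc m))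
          ⊕ + q ⊛ Conv (suc m) (λ a b →
                      (∑ (allUpHeights a) (λ x → f (suc x)) ⊕ ∑ (allUpHeights a) f) ⊛ validCount b)
  allUpHeights-step f =
    statistic-step (f 0) (λ k → ∑ (allUpHeights k) f) (λ k → ∑ (allUpHeights k) (λ x → f (suc x)))
                   refl (λ k → allUpHeights-rec k f)

  N-step : ∀ m → N (suc (suc m)) ≡ N m ⊕ validCount (suc (suc m))
  N-step m = begin
      N (suc (suc m))
    ≡⟨ allUpHeights-step sign m ⟩
      N m ⊕ 1ℤ ⊛ validCount (suc (suc m))
        ⊕ + q ⊛ Conv (suc m) (λ a b → (∑ (allUpHeights a) (λ x → - sign x) ⊕ N a) ⊛ validCount b)
    ≡⟨ cong (λ C → N m ⊕ 1ℤ ⊛ validCount (suc (suc m)) ⊕ + q ⊛ C)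
            (trans (Conv-cong (suc m) (λ a b → cong (_⊛ validCount b) (cancel a))) (Conv-zero (suc m))) ⟩
      N m ⊕ 1ℤ ⊛ validCount (suc (suc m)) ⊕ + q ⊛ 0ℤ
    ≡⟨ ring-step (N m) (validCount (suc (suc m))) (+ q) ⟩
      N m ⊕ validCount (suc (suc m))
    ∎
    where
    open ≡-Reasoning
    cancel : ∀ a → ∑ (allUpHeights a) (λ x → - sign x) ⊕ N a ≡ 0ℤ
    cancel a = trans (cong (_⊕ N a) (∑-neg (allUpHeights a) sign)) (ℤ.+-inverseˡ (N a))
    ring-step : ∀ x s ρ → x ⊕ 1ℤ ⊛ s ⊕ ρ ⊛ 0ℤ ≡ x ⊕ s
    ring-step x s ρ = solve (x ∷ s ∷ ρ ∷ [])

  W-step : ∀ m →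
    W (suc (suc m)) ≡ W m ⊕ (validCount (suc (suc m)) - + q ⊛ Conv (suc m) (λ a b → N a ⊛ validCount b))
  W-step m = begin
      W (suc (suc m))
    ≡⟨ allUpHeights-step w m ⟩
      W m ⊕ 1ℤ ⊛ validCount (suc (suc m))
        ⊕ + q ⊛ Conv (suc m) (λ a b → (∑ (allUpHeights a) (λ x → w (suc x)) ⊕ W a) ⊛ validCount b)
    ≡⟨ cong (λ C → W m ⊕ 1ℤ ⊛ validCount (suc (suc m)) ⊕ + q ⊛ C)
            (trans (Conv-cong (suc m) (λ a b → trans (cong (_⊛ validCount b) (w-lift a)) (neg-* (N a) (validCount b))))
                   (Conv-*ˡ (suc m) (- 1ℤ) (λ a b → N a ⊛ validCount b))) ⟩
      W m ⊕ 1ℤ ⊛ validCount (suc (suc m)) ⊕ + q ⊛ (- 1ℤ ⊛ M)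
    ≡⟨ ring-step (W m) (validCount (suc (suc m))) (+ q) M ⟩
      W m ⊕ (validCount (suc (suc m)) - + q ⊛ M)
    ∎
    where
    open ≡-Reasoning
    M : ℤ
    M = Conv (suc m) (λ a b → N a ⊛ validCount b)
    w-suc : ∀ σ k → - σ ⊛ (1ℤ ⊕ k) ⊕ σ ⊛ k ≡ - σ
    w-suc σ k = solve (σ ∷ k ∷ [])
    w-lift : ∀ a → ∑ (allUpHeights a) (λ x → w (suc x)) ⊕ W a ≡ - N a
    w-lift a = trans (sym (∑-+ (allUpHeights a) (λ x → w (suc x)) w))
                     (trans (∑-cong (allUpHeights a) (λ x → w-suc (sign x) (+ suc x))) (∑-neg (allUpHeights a) sign))
    neg-* : ∀ x y → - x ⊛ y ≡ - 1ℤ ⊛ (x ⊛ y)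
    neg-* x y = solve (x ∷ y ∷ [])
    ring-step : ∀ w s ρ M → w ⊕ 1ℤ ⊛ s ⊕ ρ ⊛ (- 1ℤ ⊛ M) ≡ w ⊕ (s - ρ ⊛ M)
    ring-step w s ρ M = solve (w ∷ s ∷ ρ ∷ M ∷ [])

  alternatingUpSum-closedForm : ∀ n →
    ∑ (allUpHeights (suc n + suc n)) (λ x → sign x ⊛ + suc x)
      ≡ + suc n ⊕ + q ⊛ Σℤ n (λ ℓ → + suc ℓ ⊛ validCount ((n ∸ ℓ) + (n ∸ ℓ)))
  alternatingUpSum-closedForm = W-even N W refl refl refl N-step W-step

-- The proof needs only r ≥ 1.
corollary4p4 : (r n : ℕ) → 2 ≤ r →
    Σℤ n (λ ℓ → sign ℓ ℤ.* (+ (suc ℓ * U r n ℓ)))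
      ≡ + (suc n + (r ∸ 1) * Σℕ n (λ ℓ → suc ℓ * S r (n ∸ ℓ)))
corollary4p4 zero    n ()
corollary4p4 (suc q) n _ = begin
    Σℤ n (λ ℓ → sign ℓ ⊛ + (suc ℓ * U (suc q) n ℓ))
  ≡⟨ alternatingUpSum n ⟩
    ∑ (allUpHeights (suc n + suc n)) (λ x → sign x ⊛ + suc x)
  ≡⟨ alternatingUpSum-closedForm q n ⟩
    + suc n ⊕ + q ⊛ Σℤ n (λ ℓ → + suc ℓ ⊛ validCount ((n ∸ ℓ) + (n ∸ ℓ)))
  ≡⟨ cong (λ x → + suc n ⊕ + q ⊛ x) (sym (weightedCounts n)) ⟩
    + suc n ⊕ + q ⊛ + Σℕ n (λ ℓ → suc ℓ * S (suc q) (n ∸ ℓ))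
  ≡⟨ cong (+ suc n ⊕_) (sym (ℤ.pos-* q _)) ⟩
    + (suc n + q * Σℕ n (λ ℓ → suc ℓ * S (suc q) (n ∸ ℓ)))
  ∎
  where
  open ≡-Reasoning
  open ColouredPaths (suc q)
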